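{- Let $k$ and $n$ be integers with $0\le k<n$ (and $n\geq 1$), and let $A_1,\dots,A_k$ be finite subsets of $\Omega$. Then $\bigcap_{i=1}^k\left(V_{A_i}+\operatorname{Ker}\beta^\ast_{n,n-1}\right)=\left(\bigcap_{i=1}^kV_{A_i}\right)+\operatorname{Ker}\beta^\ast_{n,n-1}$.
   Context: $\Omega$ is a countably infinite set; $[X]^m$ is the set of $m$-subsets of $X$; $\mathbb{F}_2^{[\Omega]^m}$ the $\mathbb{F}_2$-vector space of functions $[\Omega]^m\to\mathbb{F}_2$. $\beta^\ast_{n,n-1}:\mathbb{F}_2^{[\Omega]^{n-1}}\to\mathbb{F}_2^{[\Omega]^n}$, $(\beta^\ast_{n,n-1}f)(\omega)=\sum_{x\in[\omega]^{n-1}}f(x)$. For finite $A\subseteq\Omega$ and $B\subseteq A$, $V_{B,A}=\{f\in\mathbb{F}_2^{[\Omega]^{n-1}}: f(w)=0\text{ whenever }w\cap A\neq B\}$ and $V_A=\bigoplus_{B\subseteq A,|B|<n-1}V_{B,A}$. An empty intersection of subspaces of $\mathbb{F}_2^{[\Omega]^{n-1}}$ is $\mathbb{F}_2^{[\Omega]^{n-1}}$. -}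

module Defs where

open import Data.Nat using (ℕ; zero; suc; _<_; _∸_)
open import Data.Nat.Properties using (_≟_; _<?_)
open import Data.Bool using (Bool; false; _xor_)
open import Data.List using (List; []; _∷_; length; filter; foldr; map; _++_)
open import Data.List.Membership.DecPropositional _≟_ using (_∈?_)
open import Data.List.Membership.Propositional using (_∈_)
open import Data.Product using (Σ; _×_)
open import Data.Unit using (⊤)
open import Relation.Nullary using (¬_)
open import Relation.Binary.PropositionalEquality using (_≡_)

-- Ω = ℕ.  A finite subset of Ω is represented canonically by a strictly
-- increasing list of naturals.
Incr : List ℕ → Set
Incr [] = ⊤
Incr (x ∷ []) = ⊤
Incr (x ∷ y ∷ ys) = (x < y) × Incr (y ∷ ys)

_∈[Ω]^_ : List ℕ → ℕ → Set
w ∈[Ω]^ m = Incr w × (length w ≡ m)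

-- An element of F₂^{[Ω]^m} is represented by a function List ℕ → Bool
-- (Bool = F₂, xor = addition); only its values on [Ω]^m matter, and all
-- equalities between cochains below are imposed only on [Ω]^m.
Cochain : Set
Cochain = List ℕ → Bool

sumF₂ : List Bool → Bool
sumF₂ = foldr _xor_ false

choose : ℕ → List ℕ → List (List ℕ)
choose zero xs = [] ∷ []
choose (suc k) [] = []
choose (suc k) (x ∷ xs) = map (x ∷_) (choose k xs) ++ choose (suc k) xs

sublists : List ℕ → List (List ℕ)
sublists [] = [] ∷ []
sublists (x ∷ xs) = map (x ∷_) (sublists xs) ++ sublists xs

β* : ℕ → Cochain → Cochain
β* n f ω = sumF₂ (map f (choose (n ∸ 1) ω))

_∩_ : List ℕ → List ℕ → List ℕ
w ∩ A = filter (λ x → x ∈? A) w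

V[_,_] : ℕ → List ℕ → List ℕ → Cochain → Set
V[ n , B ] A f = ∀ w → w ∈[Ω]^ (n ∸ 1) → ¬ (w ∩ A ≡ B) → f w ≡ false

index : ℕ → List ℕ → List (List ℕ)
index n A = filter (λ B → length B <? n ∸ 1) (sublists A)

V : ℕ → List ℕ → Cochain → Set
V n A f = Σ (List ℕ → Cochain) λ g →
  (∀ B → B ∈ index n A → V[ n , B ] A (g B)) ×
  (∀ w → w ∈[Ω]^ (n ∸ 1) → f w ≡ sumF₂ (map (λ B → g B w) (index n A)))

Ker : ℕ → Cochain → Set
Ker n f = ∀ ω → ω ∈[Ω]^ n → β* n f ω ≡ false

Sum : ℕ → (Cochain → Set) → (Cochain → Set) → Cochain → Set
Sum m U W f = Σ Cochain λ u → Σ Cochain λ v →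
  U u × W v × (∀ w → w ∈[Ω]^ m → f w ≡ (u w xor v w))

-- Write m = n - 1. Since A is finite, V_A consists exactly of the cochains vanishing on [A]^m, so
-- f ∈ V_A + Ker β* means that f agrees on [A]^m with a global cocycle; in particular f is a cocycle
-- on A, i.e. β* f vanishes on [A]^(m+1). The theorem thus says that a cochain which is a cocycle on
-- each of k ≤ m finite sets agrees on all of them with one global cocycle. Induct on k: given such a
-- global cocycle v₁ for A₁,…,A_(k-1), the cochain z = f + v₁ is a cocycle on A₀ vanishing on every A_j.
-- On the full simplex A₀ = {a} ∪ A′ (a = min A₀), z is the coboundary of its cone c(s) = z({a} ∪ s),
-- s ⊆ A′; hence c is a cocycle of one dimension less on each A₀ ∩ A_j, and by induction (k - 1 sets,
-- dimension m - 1) agrees there with a global cocycle e. Then h = c + e, cut off outside A₀, vanishes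
-- on every A_j, and since β* ∘ β* = 0, v = v₁ + β* h is a global cocycle agreeing with f on every A_i.

module Submission where

open import Defs
open import Algebra.Bundles using (CommutativeRing)
open import Data.Bool using (Bool; true; false; _xor_; _∧_; if_then_else_)
open import Data.Bool.Properties
  using (xor-assoc; xor-comm; xor-same; xor-identityʳ; xor-∧-commutativeRing; ∧-distribˡ-xor; ∧-zeroʳ; ∧-identityʳ)
open import Algebra.Properties.CommutativeSemigroup
  (CommutativeRing.+-commutativeSemigroup xor-∧-commutativeRing) using (interchange)
open import Data.Empty using (⊥-elim)
open import Data.Fin using (Fin; zero; suc)
open import Data.List using (List; []; _∷_; [_]; _++_; map; filter; length)
open import Data.List.Properties using (map-++; map-∘; ≡-dec; filter-all; filter-notAll)
open import Data.List.Membership.Propositional using (_∈_; _∉_)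
open import Data.List.Membership.Propositional.Properties using (∈-++⁻; map∷⁻; ∈-filter⁺; ∈-filter⁻)
open import Data.Nat using (ℕ; zero; suc; _<_; _≤_; _<?_; _∸_; s≤s)
open import Data.Nat.Properties
  using (_≟_; <-trans; <-irrefl; <⇒≢; <-≤-trans; ≤-reflexive; ≤-refl; m≤n⇒m≤1+n; suc-injective)
open import Data.List.Membership.DecPropositional _≟_ using (_∈?_)
open import Data.List.Relation.Unary.All as All using (All; []; _∷_; all?)
open import Data.List.Relation.Unary.All.Properties using (All¬⇒¬Any; ¬All⇒Any¬; all-filter)
open import Data.List.Relation.Unary.AllPairs as AllPairs using (AllPairs; []; _∷_)
open import Data.List.Relation.Unary.Any using (here; there)
open import Data.List.Relation.Unary.Unique.Propositional using (Unique)
open import Data.List.Relation.Binary.Sublist.Propositional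
  using ([]; _∷_; _∷ʳ_; minimum) renaming (_⊆_ to _⊑_)
open import Data.List.Relation.Binary.Sublist.Propositional.Properties using (All-resp-⊆; Any-resp-⊆; filter-⊆)
open import Data.Product using (Σ; _×_; _,_; proj₁; proj₂; uncurry)
open import Data.Sum using (inj₁; inj₂)
open import Data.Unit using (tt)
open import Function using (_∘_)
open import Relation.Binary.Definitions using (DecidableEquality)
open import Relation.Binary.PropositionalEquality
  using (_≡_; _≢_; refl; sym; trans; cong; cong₂; ≢-sym; module ≡-Reasoning)
open import Relation.Nullary using (¬_; yes; no; does)
open import Relation.Nullary.Decidable using (dec-true; dec-false)
open import Relation.Unary using (Pred; Decidable)

xor-cancelʳ : ∀ x y → (x xor y) xor y ≡ x
xor-cancelʳ x y = trans (xor-assoc x y y) (trans (cong (x xor_) (xor-same y)) (xor-identityʳ x))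

xor≡false⇒≡ : ∀ x y → x xor y ≡ false → x ≡ y
xor≡false⇒≡ false false _ = refl
xor≡false⇒≡ true  true  _ = refl

sumF₂-++ : ∀ xs ys → sumF₂ (xs ++ ys) ≡ sumF₂ xs xor sumF₂ ys
sumF₂-++ []       ys = refl
sumF₂-++ (x ∷ xs) ys = trans (cong (x xor_) (sumF₂-++ xs ys)) (sym (xor-assoc x _ _))

module _ {A : Set} where

  sumF₂-cong : ∀ {f g : A → Bool} L → (∀ x → x ∈ L → f x ≡ g x) → sumF₂ (map f L) ≡ sumF₂ (map g L)
  sumF₂-cong []      f≡g = refl
  sumF₂-cong (x ∷ L) f≡g = cong₂ _xor_ (f≡g x (here refl)) (sumF₂-cong L (λ y → f≡g y ∘ there))

  sumF₂-zero : ∀ {f : A → Bool} L → (∀ x → x ∈ L → f x ≡ false) → sumF₂ (map f L) ≡ false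
  sumF₂-zero []      f≡0 = refl
  sumF₂-zero (x ∷ L) f≡0 rewrite f≡0 x (here refl) = sumF₂-zero L (λ y → f≡0 y ∘ there)

  sumF₂-xor : ∀ (f g : A → Bool) L →
              sumF₂ (map (λ x → f x xor g x) L) ≡ sumF₂ (map f L) xor sumF₂ (map g L)
  sumF₂-xor f g []      = refl
  sumF₂-xor f g (x ∷ L) = trans (cong ((f x xor g x) xor_) (sumF₂-xor f g L)) (interchange (f x) (g x) _ _)

  sumF₂-∧ˡ : ∀ b (f : A → Bool) L → sumF₂ (map (λ x → b ∧ f x) L) ≡ b ∧ sumF₂ (map f L)
  sumF₂-∧ˡ b f []      = sym (∧-zeroʳ b)
  sumF₂-∧ˡ b f (x ∷ L) = trans (cong ((b ∧ f x) xor_) (sumF₂-∧ˡ b f L)) (sym (∧-distribˡ-xor b (f x) _))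

  sumF₂-filter : ∀ {ℓ} {P : Pred A ℓ} (P? : Decidable P) {f : A → Bool} L →
                 (∀ x → ¬ P x → f x ≡ false) → sumF₂ (map f (filter P? L)) ≡ sumF₂ (map f L)
  sumF₂-filter P?     []      f≡0 = refl
  sumF₂-filter P? {f} (x ∷ L) f≡0 with P? x
  ... | yes _             = cong (f x xor_) (sumF₂-filter P? L f≡0)
  ... | no ¬px rewrite f≡0 x ¬px = sumF₂-filter P? L f≡0

  sumF₂-split : ∀ (f : List A → Bool) x L L′ →
                sumF₂ (map f (map (x ∷_) L ++ L′)) ≡ sumF₂ (map (f ∘ (x ∷_)) L) xor sumF₂ (map f L′)
  sumF₂-split f x L L′ = begin
    sumF₂ (map f (map (x ∷_) L ++ L′))
      ≡⟨ cong sumF₂ (map-++ f (map (x ∷_) L) L′) ⟩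
    sumF₂ (map f (map (x ∷_) L) ++ map f L′)
      ≡⟨ sumF₂-++ (map f (map (x ∷_) L)) (map f L′) ⟩
    sumF₂ (map f (map (x ∷_) L)) xor sumF₂ (map f L′)
      ≡⟨ cong (λ ys → sumF₂ ys xor sumF₂ (map f L′)) (sym (map-∘ L)) ⟩
    sumF₂ (map (f ∘ (x ∷_)) L) xor sumF₂ (map f L′) ∎
    where open ≡-Reasoning

incr⇒sorted : ∀ {xs} → Incr xs → AllPairs _<_ xs
incr⇒sorted {[]}         _         = []
incr⇒sorted {x ∷ []}     _         = [] ∷ []
incr⇒sorted {x ∷ y ∷ ys} (x<y , i) with incr⇒sorted i
... | y<ys ∷ s = (x<y ∷ All.map (<-trans x<y) y<ys) ∷ y<ys ∷ s

sorted⇒incr : ∀ {xs} → AllPairs _<_ xs → Incr xs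
sorted⇒incr []                      = tt
sorted⇒incr (_ ∷ [])                = tt
sorted⇒incr ((x<y ∷ _) ∷ s@(_ ∷ _)) = x<y , sorted⇒incr s

AllPairs-resp-⊑ : ∀ {A : Set} {R : A → A → Set} {xs ys : List A} → xs ⊑ ys → AllPairs R ys → AllPairs R xs
AllPairs-resp-⊑ []         []      = []
AllPairs-resp-⊑ (_ ∷ʳ p)   (_ ∷ s) = AllPairs-resp-⊑ p s
AllPairs-resp-⊑ (refl ∷ p) (r ∷ s) = All-resp-⊆ p r ∷ AllPairs-resp-⊑ p s

Incr-resp-⊑ : ∀ {xs ys} → xs ⊑ ys → Incr ys → Incr xs
Incr-resp-⊑ p = sorted⇒incr ∘ AllPairs-resp-⊑ p ∘ incr⇒sorted

head<tail : ∀ {x xs} → Incr (x ∷ xs) → All (x <_) xs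
head<tail = AllPairs.head ∘ incr⇒sorted

head∉tail : ∀ {x xs} → Incr (x ∷ xs) → x ∉ xs
head∉tail i x∈ = <-irrefl refl (All.lookup (head<tail i) x∈)

∈-∷⁻ : ∀ {x y : ℕ} {ys} → x ∈ y ∷ ys → y ≢ x → x ∈ ys
∈-∷⁻ (here refl) y≢y = ⊥-elim (y≢y refl)
∈-∷⁻ (there x∈)  _   = x∈

∈-tail : ∀ {xs} {y : ℕ} {ys} → All (_∈ y ∷ ys) xs → All (y ≢_) xs → All (_∈ ys) xs
∈-tail xs⊆ y≢xs = All.zipWith (uncurry ∈-∷⁻) (xs⊆ , y≢xs)

sorted-⊆⇒⊑ : ∀ {c A} → AllPairs _<_ c → AllPairs _<_ A → All (_∈ A) c → c ⊑ A
sorted-⊆⇒⊑ {[]}    {A}     _              _          _             = minimum A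
sorted-⊆⇒⊑ {x ∷ c} {y ∷ A} sc@(x<c ∷ sc′) (y<A ∷ sA) xc⊆@(x∈ ∷ c⊆) with x ≟ y
... | yes refl = refl ∷ sorted-⊆⇒⊑ sc′ sA (∈-tail c⊆ (All.map <⇒≢ x<c))
... | no x≢y   = y ∷ʳ sorted-⊆⇒⊑ sc sA (∈-tail xc⊆ (All.map <⇒≢ (y<x ∷ All.map (<-trans y<x) x<c)))
  where y<x = All.lookup y<A (∈-∷⁻ x∈ (≢-sym x≢y))

⊆-∩ : ∀ {X Y s} → All (_∈ X) s → All (_∈ Y) s → All (_∈ X ∩ Y) s
⊆-∩ {Y = Y} s⊆X s⊆Y = All.zipWith (uncurry (∈-filter⁺ (_∈? Y))) (s⊆X , s⊆Y)

∩-⊆ˡ : ∀ {X Y s} → All (_∈ X ∩ Y) s → All (_∈ X) s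
∩-⊆ˡ {X} {Y} = All.map (proj₁ ∘ ∈-filter⁻ (_∈? Y) {xs = X})

∩-⊆ʳ : ∀ {X Y s} → All (_∈ X ∩ Y) s → All (_∈ Y) s
∩-⊆ʳ {X} {Y} = All.map (proj₂ ∘ ∈-filter⁻ (_∈? Y) {xs = X})

Incr-∩ : ∀ {X} Y → Incr X → Incr (X ∩ Y)
Incr-∩ {X} Y = Incr-resp-⊑ (filter-⊆ (_∈? Y) X)

choose-sound : ∀ r w {s} → s ∈ choose r w → s ⊑ w × length s ≡ r
choose-sound zero    w       (here refl) = minimum w , refl
choose-sound (suc r) (x ∷ w) s∈ with ∈-++⁻ (map (x ∷_) (choose r w)) s∈
... | inj₁ s∈′ with _ , t∈ , refl ← map∷⁻ s∈′ with t⊑w , len ← choose-sound r w t∈ =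
  refl ∷ t⊑w , cong suc len
... | inj₂ s∈′ with s⊑w , len ← choose-sound (suc r) w s∈′ = x ∷ʳ s⊑w , len

sublists-sound : ∀ A {s} → s ∈ sublists A → s ⊑ A
sublists-sound []      (here refl) = []
sublists-sound (x ∷ A) s∈ with ∈-++⁻ (map (x ∷_) (sublists A)) s∈
... | inj₁ s∈′ with _ , t∈ , refl ← map∷⁻ s∈′ = refl ∷ sublists-sound A t∈
... | inj₂ s∈′ = x ∷ʳ sublists-sound A s∈′

choose-short : ∀ r w → length w < r → choose r w ≡ []
choose-short (suc r) []      _         = refl
choose-short (suc r) (x ∷ w) (s≤s len)
  rewrite choose-short r w len | choose-short (suc r) w (m≤n⇒m≤1+n len) = refl

choose-full : ∀ w → choose (length w) w ≡ [ w ]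
choose-full []      = refl
choose-full (x ∷ w) rewrite choose-full w | choose-short (suc (length w)) w ≤-refl = refl

_∈[_]^_ : List ℕ → List ℕ → ℕ → Set
w ∈[ A ]^ m = w ∈[Ω]^ m × All (_∈ A) w

face : ∀ {A w n r s} → w ∈[ A ]^ n → s ∈ choose r w → s ∈[ A ]^ r
face ((iw , _) , w⊆A) s∈ with s⊑w , len ← choose-sound _ _ s∈ =
  (Incr-resp-⊑ s⊑w iw , len) , All-resp-⊆ s⊑w w⊆A

infixl 6 _+ᶜ_

_+ᶜ_ : Cochain → Cochain → Cochain
(f +ᶜ g) w = f w xor g w

0ᶜ : Cochain
0ᶜ _ = false

AgreeOn : ℕ → List ℕ → Cochain → Cochain → Set
AgreeOn m A f g = ∀ w → w ∈[ A ]^ m → f w ≡ g w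

VanishesOn : ℕ → List ℕ → Cochain → Set
VanishesOn m A f = AgreeOn m A f 0ᶜ

agree⇒+-vanishes : ∀ {m A f g} → AgreeOn m A f g → VanishesOn m A (f +ᶜ g)
agree⇒+-vanishes {g = g} f≈g w w∈ = trans (cong (_xor g w) (f≈g w w∈)) (xor-same (g w))

cone : ℕ → Cochain → Cochain
cone x f s = f (x ∷ s)

β*-+ : ∀ n f g ω → β* n (f +ᶜ g) ω ≡ β* n f ω xor β* n g ω
β*-+ n f g ω = sumF₂-xor f g (choose (n ∸ 1) ω)

β*-0ᶜ : ∀ n ω → β* n 0ᶜ ω ≡ false
β*-0ᶜ n ω = sumF₂-zero (choose (n ∸ 1) ω) (λ _ _ → refl)

β*-agree : ∀ {m A f g} → AgreeOn m A f g → AgreeOn (suc m) A (β* (suc m) f) (β* (suc m) g)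
β*-agree {m} f≈g ω ω∈ = sumF₂-cong (choose m ω) (λ s s∈ → f≈g s (face ω∈ s∈))

β*-vanishes : ∀ {m A f} → VanishesOn m A f → VanishesOn (suc m) A (β* (suc m) f)
β*-vanishes {m} f≡0 ω ω∈ = trans (β*-agree f≡0 ω ω∈) (β*-0ᶜ (suc m) ω)

β*-cons : ∀ r f x w → β* (suc (suc r)) f (x ∷ w) ≡ β* (suc r) (cone x f) w xor β* (suc (suc r)) f w
β*-cons r f x w = sumF₂-split f x (choose r w) (choose (suc r) w)

β*-full : ∀ {r} f w → length w ≡ r → β* (suc r) f w ≡ f w
β*-full f w refl rewrite choose-full w = xor-identityʳ (f w)

β*-cone-β* : ∀ r g x ω → length ω ≡ suc r → β* (suc r) (cone x (β* (suc r) g)) ω ≡ β* (suc r) g ω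
β*∘β* : ∀ r g ω → length ω ≡ suc (suc r) → β* (suc (suc r)) (β* (suc r) g) ω ≡ false

β*-cone-β* zero    g x ω _   = xor-identityʳ _
β*-cone-β* (suc r) g x ω len = begin
  β* (suc (suc r)) (cone x (β* (suc (suc r)) g)) ω
    ≡⟨ sumF₂-cong (choose (suc r) ω) (λ t t∈ →
         trans (β*-cons r g x t) (cong (β* (suc r) (cone x g) t xor_) (β*-full g t (proj₂ (choose-sound (suc r) ω t∈))))) ⟩
  β* (suc (suc r)) (β* (suc r) (cone x g) +ᶜ g) ω
    ≡⟨ β*-+ (suc (suc r)) _ g ω ⟩
  β* (suc (suc r)) (β* (suc r) (cone x g)) ω xor β* (suc (suc r)) g ω
    ≡⟨ cong (_xor β* (suc (suc r)) g ω) (β*∘β* r (cone x g) ω len) ⟩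
  β* (suc (suc r)) g ω ∎
  where open ≡-Reasoning

β*∘β* r g (x ∷ ω) len = begin
  β* (suc (suc r)) F (x ∷ ω)                         ≡⟨ β*-cons r F x ω ⟩
  β* (suc r) (cone x F) ω xor β* (suc (suc r)) F ω  ≡⟨ cong₂ _xor_ (β*-cone-β* r g x ω ω-len) (β*-full F ω ω-len) ⟩
  F ω xor F ω                                        ≡⟨ xor-same (F ω) ⟩
  false                                              ∎
  where
    open ≡-Reasoning
    F = β* (suc r) g
    ω-len = suc-injective len

Ker-+ : ∀ {n f g} → Ker n f → Ker n g → Ker n (f +ᶜ g)
Ker-+ {n} {f} {g} f∈K g∈K ω ω∈ = trans (β*-+ n f g ω) (cong₂ _xor_ (f∈K ω ω∈) (g∈K ω ω∈))

Ker-0ᶜ : ∀ {n} → Ker n 0ᶜ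
Ker-0ᶜ {n} ω _ = β*-0ᶜ n ω

Ker-β* : ∀ {r} g → Ker (suc (suc r)) (β* (suc r) g)
Ker-β* {r} g ω (_ , len) = β*∘β* r g ω len

restrict : List ℕ → Cochain → Cochain
restrict A f s = if does (all? (_∈? A) s) then f s else false

restrict-⊆ : ∀ {A} f {s} → All (_∈ A) s → restrict A f s ≡ f s
restrict-⊆ {A} f {s} s⊆A rewrite dec-true (all? (_∈? A) s) s⊆A = refl

restrict-⊈ : ∀ {A} f {s} → ¬ All (_∈ A) s → restrict A f s ≡ false
restrict-⊈ {A} f {s} s⊈A rewrite dec-false (all? (_∈? A) s) s⊈A = refl

-- For A increasing, its head is the apex of the cone.
coneOn : List ℕ → Cochain → Cochain
coneOn []      z = 0ᶜ
coneOn (a ∷ A) z = restrict A (cone a z)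

β*-coneOn : ∀ {m A z} → Incr A → VanishesOn (suc (suc m)) A (β* (suc (suc m)) z) →
            AgreeOn (suc m) A (β* (suc m) (coneOn A z)) z
β*-coneOn {A = []} _ _ (_ ∷ _) (_ , () ∷ _)
β*-coneOn {m} {a ∷ A} {z} iA z-cocycle (y ∷ w) ((iw , len) , y∈ ∷ w⊆) with y ≟ a
... | yes refl = apex m w (suc-injective len) (∈-tail w⊆ (All.map <⇒≢ (head<tail iw)))
  where
    h = restrict A (cone a z)
    apex : ∀ m w → length w ≡ m → All (_∈ A) w → β* (suc m) h (a ∷ w) ≡ z (a ∷ w)
    apex zero    []  _   _   = xor-identityʳ (h [])
    apex (suc m) w   len w⊆A = begin
      β* (suc (suc m)) h (a ∷ w)
        ≡⟨ β*-cons m h a w ⟩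
      β* (suc m) (cone a h) w xor β* (suc (suc m)) h w
        ≡⟨ cong₂ _xor_ (sumF₂-zero (choose m w) (λ t _ → restrict-⊈ (cone a z) (head∉tail iA ∘ All.head)))
                       (trans (β*-full h w len) (restrict-⊆ (cone a z) w⊆A)) ⟩
      z (a ∷ w) ∎
      where open ≡-Reasoning
... | no y≢a = xor≡false⇒≡ _ _ (begin
      β* (suc m) h (y ∷ w) xor z (y ∷ w)
        ≡⟨ cong₂ _xor_ (β*-agree (λ s s∈ → restrict-⊆ (cone a z) (proj₂ s∈)) (y ∷ w) ((iw , len) , yw⊆A))
                       (sym (β*-full z (y ∷ w) len)) ⟩
      β* (suc m) (cone a z) (y ∷ w) xor β* (suc (suc m)) z (y ∷ w)
        ≡⟨ sym (β*-cons m z a (y ∷ w)) ⟩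
      β* (suc (suc m)) z (a ∷ y ∷ w)
        ≡⟨ z-cocycle (a ∷ y ∷ w) (((a<y , iw) , cong suc len) , here refl ∷ y∈ ∷ w⊆) ⟩
      false ∎)
  where
    open ≡-Reasoning
    h = restrict A (cone a z)
    y∈A = ∈-∷⁻ y∈ (≢-sym y≢a)
    a<y = All.lookup (head<tail iA) y∈A
    yw⊆A = ∈-tail (y∈ ∷ w⊆) (All.map <⇒≢ (a<y ∷ All.map (<-trans a<y) (head<tail iw)))

infix 4 _≟ₗ_

_≟ₗ_ : DecidableEquality (List ℕ)
_≟ₗ_ = ≡-dec _≟_

does-≟ₗ-∷ : ∀ x c B → does (x ∷ c ≟ₗ x ∷ B) ≡ does (c ≟ₗ B)
does-≟ₗ-∷ x c B = cong (_∧ does (c ≟ₗ B)) (dec-true (x ≟ x) refl)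

sublists-count : ∀ {c A} → Unique A → c ⊑ A → sumF₂ (map (λ B → does (c ≟ₗ B)) (sublists A)) ≡ true
sublists-count [] [] = refl
sublists-count {c} {y ∷ A} (y∉A ∷ uA) (.y ∷ʳ c⊑A) = begin
  sumF₂ (map (λ B → does (c ≟ₗ B)) (map (y ∷_) (sublists A) ++ sublists A))
    ≡⟨ sumF₂-split _ y (sublists A) (sublists A) ⟩
  sumF₂ (map (λ B → does (c ≟ₗ y ∷ B)) (sublists A)) xor sumF₂ (map (λ B → does (c ≟ₗ B)) (sublists A))
    ≡⟨ cong₂ _xor_ (sumF₂-zero (sublists A) (λ B _ → dec-false (c ≟ₗ y ∷ B) λ { refl →
                      All¬⇒¬Any y∉A (Any-resp-⊆ c⊑A (here refl)) }))
                   (sublists-count uA c⊑A) ⟩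
  true ∎
  where open ≡-Reasoning
sublists-count {x ∷ c} {x ∷ A} (x∉A ∷ uA) (refl ∷ c⊑A) = begin
  sumF₂ (map (λ B → does (x ∷ c ≟ₗ B)) (map (x ∷_) (sublists A) ++ sublists A))
    ≡⟨ sumF₂-split _ x (sublists A) (sublists A) ⟩
  sumF₂ (map (λ B → does (x ∷ c ≟ₗ x ∷ B)) (sublists A)) xor sumF₂ (map (λ B → does (x ∷ c ≟ₗ B)) (sublists A))
    ≡⟨ cong₂ _xor_ (trans (sumF₂-cong (sublists A) (λ B _ → does-≟ₗ-∷ x c B)) (sublists-count uA c⊑A))
                   (sumF₂-zero (sublists A) (λ B B∈ → dec-false (x ∷ c ≟ₗ B) λ { refl →
                      All¬⇒¬Any x∉A (Any-resp-⊆ (sublists-sound A B∈) (here refl)) })) ⟩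
  true ∎
  where open ≡-Reasoning

V⇒vanishes : ∀ {m A u} → V (suc m) A u → VanishesOn m A u
V⇒vanishes {m} {A} (g , g∈V , u≡Σg) w ((iw , len) , w⊆A) =
  trans (u≡Σg w (iw , len)) (sumF₂-zero (index (suc m) A) (λ B B∈ → g∈V B B∈ w (iw , len) (w∩A≢B B∈)))
  where
    w∩A≢B : ∀ {B} → B ∈ index (suc m) A → w ∩ A ≢ B
    w∩A≢B B∈ refl = <-irrefl (trans (cong length (filter-all (_∈? A) w⊆A)) len)
                              (proj₂ (∈-filter⁻ (λ B → length B <? m) {xs = sublists A} B∈))

-- An m-set w ⊈ A lies in the support of exactly one summand, V_{w ∩ A, A}.
vanishes⇒V : ∀ {m A u} → Incr A → VanishesOn m A u → V (suc m) A u
vanishes⇒V {m} {A} {u} iA u≡0 = g , g∈V , u≡Σg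
  where
    g : List ℕ → Cochain
    g B w = u w ∧ does (w ∩ A ≟ₗ B)
    g∈V : ∀ B → B ∈ index (suc m) A → V[ suc m , B ] A (g B)
    g∈V B _ w _ w∩A≢B = trans (cong (u w ∧_) (dec-false (w ∩ A ≟ₗ B) w∩A≢B)) (∧-zeroʳ (u w))
    u≡Σg : ∀ w → w ∈[Ω]^ m → u w ≡ sumF₂ (map (λ B → g B w) (index (suc m) A))
    u≡Σg w (iw , len) with all? (_∈? A) w
    ... | yes w⊆A rewrite u≡0 w ((iw , len) , w⊆A) = sym (sumF₂-zero (index (suc m) A) (λ _ _ → refl))
    ... | no w⊈A = sym (trans (sumF₂-∧ˡ (u w) _ (index (suc m) A)) (trans (cong (u w ∧_) once) (∧-identityʳ (u w))))
      where
        w∩A<m : length (w ∩ A) < m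
        w∩A<m = <-≤-trans (filter-notAll (_∈? A) w (¬All⇒Any¬ (_∈? A) w w⊈A)) (≤-reflexive len)
        w∩A⊑A : w ∩ A ⊑ A
        w∩A⊑A = sorted-⊆⇒⊑ (incr⇒sorted (Incr-∩ A iw)) (incr⇒sorted iA) (all-filter (_∈? A) w)
        once : sumF₂ (map (λ B → does (w ∩ A ≟ₗ B)) (index (suc m) A)) ≡ true
        once = trans (sumF₂-filter _ (sublists A) (λ B B≮m → dec-false (w ∩ A ≟ₗ B) λ { refl → B≮m w∩A<m }))
                     (sublists-count (AllPairs.map <⇒≢ (incr⇒sorted iA)) w∩A⊑A)

Sum⇒cocycle : ∀ {m A f} → Sum m (V (suc m) A) (Ker (suc m)) f → VanishesOn (suc m) A (β* (suc m) f)
Sum⇒cocycle {m} {A} {f} (u , v , u∈V , v∈K , f≡u+v) ω ω∈ = begin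
  β* (suc m) f ω                     ≡⟨ β*-agree (λ w w∈ → f≡u+v w (proj₁ w∈)) ω ω∈ ⟩
  β* (suc m) (u +ᶜ v) ω              ≡⟨ β*-+ (suc m) u v ω ⟩
  β* (suc m) u ω xor β* (suc m) v ω  ≡⟨ cong₂ _xor_ (β*-vanishes (V⇒vanishes u∈V) ω ω∈) (v∈K ω (proj₁ ω∈)) ⟩
  false                              ∎
  where open ≡-Reasoning

cocycle-+ : ∀ {m A z v} → VanishesOn (suc m) A (β* (suc m) z) → Ker (suc m) v →
            VanishesOn (suc m) A (β* (suc m) (z +ᶜ v))
cocycle-+ {m} {z = z} {v} z-cocycle v∈K ω ω∈ = trans (β*-+ (suc m) z v ω) (cong₂ _xor_ (z-cocycle ω ω∈) (v∈K ω (proj₁ ω∈)))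

coneOn-cocycle : ∀ {m A X z} → Incr A → VanishesOn (suc (suc m)) A (β* (suc (suc m)) z) →
                 VanishesOn (suc m) X z → VanishesOn (suc m) (A ∩ X) (β* (suc m) (coneOn A z))
coneOn-cocycle {A = A} {X} iA z-cocycle z≡0 ω (ω∈Ω , ω⊆) =
  trans (β*-coneOn iA z-cocycle ω (ω∈Ω , ∩-⊆ˡ {A} {X} ω⊆)) (z≡0 ω (ω∈Ω , ∩-⊆ʳ {A} {X} ω⊆))

β*-restrict-coneOn : ∀ {m A z e} → Incr A → VanishesOn (suc (suc m)) A (β* (suc (suc m)) z) → Ker (suc m) e →
                     AgreeOn (suc m) A (β* (suc m) (restrict A (coneOn A z +ᶜ e))) z
β*-restrict-coneOn {m} {A} {z} {e} iA z-cocycle e∈K ω ω∈ = begin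
  β* (suc m) (restrict A (coneOn A z +ᶜ e)) ω
    ≡⟨ β*-agree (λ s s∈ → restrict-⊆ (coneOn A z +ᶜ e) (proj₂ s∈)) ω ω∈ ⟩
  β* (suc m) (coneOn A z +ᶜ e) ω
    ≡⟨ β*-+ (suc m) (coneOn A z) e ω ⟩
  β* (suc m) (coneOn A z) ω xor β* (suc m) e ω
    ≡⟨ cong₂ _xor_ (β*-coneOn iA z-cocycle ω ω∈) (e∈K ω (proj₁ ω∈)) ⟩
  z ω xor false
    ≡⟨ xor-identityʳ (z ω) ⟩
  z ω ∎
  where open ≡-Reasoning

restrict-vanishes : ∀ {m A X f g} → AgreeOn m (A ∩ X) f g → VanishesOn m X (restrict A (f +ᶜ g))
restrict-vanishes {A = A} {f = f} {g} f≈g s (s∈Ω , s⊆X) with all? (_∈? A) s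
... | yes s⊆A = agree⇒+-vanishes f≈g s (s∈Ω , ⊆-∩ s⊆A s⊆X)
... | no _    = refl

extend-local-cocycles : ∀ {k m} → k ≤ m → (A : Fin k → List ℕ) → (∀ i → Incr (A i)) →
         (z : Cochain) → (∀ i → VanishesOn (suc m) (A i) (β* (suc m) z)) →
         Σ Cochain λ v → Ker (suc m) v × (∀ i → AgreeOn m (A i) z v)
extend-local-cocycles {zero} _ A iA z _ = 0ᶜ , Ker-0ᶜ , λ ()
extend-local-cocycles {suc k} {suc m} (s≤s k≤m) A iA z z-cocycle
  with v₁ , v₁∈K , z≈v₁ ← extend-local-cocycles (m≤n⇒m≤1+n k≤m) (A ∘ suc) (iA ∘ suc) z (z-cocycle ∘ suc)
  with z′-cocycle ← cocycle-+ (z-cocycle zero) v₁∈K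
  with e , e∈K , cone≈e ← extend-local-cocycles k≤m (λ j → A zero ∩ A (suc j)) (λ j → Incr-∩ (A (suc j)) (iA zero))
                            (coneOn (A zero) (z +ᶜ v₁))
                            (λ j → coneOn-cocycle (iA zero) z′-cocycle (agree⇒+-vanishes (z≈v₁ j)))
  = v₁ +ᶜ β* (suc m) h , Ker-+ v₁∈K (Ker-β* h) , agree
  where
    h = restrict (A zero) (coneOn (A zero) (z +ᶜ v₁) +ᶜ e)
    agree : ∀ i → AgreeOn (suc m) (A i) z (v₁ +ᶜ β* (suc m) h)
    agree zero w w∈ = sym (begin
      v₁ w xor β* (suc m) h w    ≡⟨ cong (v₁ w xor_) (β*-restrict-coneOn (iA zero) z′-cocycle e∈K w w∈) ⟩
      v₁ w xor (z w xor v₁ w)    ≡⟨ xor-comm (v₁ w) _ ⟩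
      (z w xor v₁ w) xor v₁ w    ≡⟨ xor-cancelʳ (z w) (v₁ w) ⟩
      z w                        ∎)
      where open ≡-Reasoning
    agree (suc j) w w∈ = begin
      z w                        ≡⟨ z≈v₁ j w w∈ ⟩
      v₁ w                       ≡⟨ sym (xor-identityʳ (v₁ w)) ⟩
      v₁ w xor false             ≡⟨ cong (v₁ w xor_) (sym (β*-vanishes (restrict-vanishes (cone≈e j)) w w∈)) ⟩
      v₁ w xor β* (suc m) h w    ∎
      where open ≡-Reasoning

lemma5p1 : (n k : ℕ) → 1 ≤ n → k < n →
    (A : Fin k → List ℕ) → (∀ i → Incr (A i)) →
    (f : Cochain) →
      ((∀ i → Sum (n ∸ 1) (V n (A i)) (Ker n) f) → Sum (n ∸ 1) (λ g → ∀ i → V n (A i) g) (Ker n) f)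
      × (Sum (n ∸ 1) (λ g → ∀ i → V n (A i) g) (Ker n) f → (∀ i → Sum (n ∸ 1) (V n (A i)) (Ker n) f))
lemma5p1 (suc m) k _ (s≤s k≤m) A iA f = ∩⊆ , ⊆∩
  where
    ∩⊆ : (∀ i → Sum m (V (suc m) (A i)) (Ker (suc m)) f) → Sum m (λ g → ∀ i → V (suc m) (A i) g) (Ker (suc m)) f
    ∩⊆ f∈ with v , v∈K , f≈v ← extend-local-cocycles k≤m A iA f (Sum⇒cocycle ∘ f∈) =
      f +ᶜ v , v , (λ i → vanishes⇒V (iA i) (agree⇒+-vanishes (f≈v i))) , v∈K , (λ w _ → sym (xor-cancelʳ (f w) (v w)))
    ⊆∩ : Sum m (λ g → ∀ i → V (suc m) (A i) g) (Ker (suc m)) f → ∀ i → Sum m (V (suc m) (A i)) (Ker (suc m)) f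
    ⊆∩ (u , v , u∈V , v∈K , f≡u+v) i = u , v , u∈V i , v∈K , f≡u+v
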